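{- Let $n\ge 1$ be an integer and let $A\subseteq\mathbb{Z}_{\ge 0}^n$ be a finite, non-empty downset. Then $$\frac{1}{|A|}\sum_{a\in A} w(a)\le \frac12\log_2|A|.$$
   Context: $\mathbb{Z}_{\ge0}$ is the set of non-negative integers. A set $A\subseteq\mathbb{Z}_{\ge0}^n$ is a downset if for every $a\in A$ and every $z\in\mathbb{Z}_{\ge0}^n$ with $z\le a$ coordinate-wise, $z\in A$. The weight $w(z)$ of a vector $z\in\mathbb{Z}^n$ is the number of its non-zero coordinates. -}

module Defs where

open import Data.Nat using (ℕ; zero; suc; _+_; _≤_)
open import Data.Vec using (Vec; []; _∷_)
open import Data.List using (List)
open import Data.List.Membership.Propositional using (_∈_)
open import Data.Vec.Relation.Binary.Pointwise.Inductive using (Pointwise)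

w : ∀ {n} → Vec ℕ n → ℕ
w []            = 0
w (zero  ∷ xs)  = w xs
w (suc _ ∷ xs)  = suc (w xs)

_≤ᵥ_ : ∀ {n} → Vec ℕ n → Vec ℕ n → Set
z ≤ᵥ a = Pointwise _≤_ z a

-- a finite set A ⊆ ℕ^n (given as a duplicate-free list) is a downset
IsDownset : ∀ {n} → List (Vec ℕ n) → Set
IsDownset A = ∀ a z → a ∈ A → z ≤ᵥ a → z ∈ A

{-# OPTIONS --safe #-}
-- With W(A) the total weight, the claim reads 4^W(A) ≤ |A|^|A|. Split A along the first
-- coordinate into the slice B = {t | (0,t) ∈ A} and the shift C = {(k,t) | (k+1,t) ∈ A}. Both
-- are downsets, |A| = |B| + |C| and W(A) = W(B) + W(C) + z, where z = |{t | (1,t) ∈ A}| is at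
-- most min(|B|,|C|) because A is a downset. Induction on the dimension (for B) and on |A| (for
-- C) therefore reduces the theorem to b^b c^c 4^min(b,c) ≤ (b+c)^(b+c), an integer form of
-- H(p) ≥ 2 min(p, 1-p) for the binary entropy. For b = c this is an equality, and it persists
-- as b grows because (x+1)^(x+1) / x^x is nondecreasing, i.e. x ↦ x^x is log-convex.
module Submission where

open import Defs
open import Data.Nat
open import Data.Nat.Properties
open import Data.Nat.Tactic.RingSolver using (solve-∀)
open import Data.Nat.ListAction using (sum)
open import Data.Sum using (inj₁; inj₂)
open import Data.Empty using (⊥-elim)
open import Data.Vec using (Vec; []; _∷_)
open import Data.Vec.Relation.Binary.Pointwise.Inductive as Pointwise using (_∷_)
open import Data.List using (List; []; _∷_; length; map)
open import Data.List.Properties using (length-removeAt′)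
open import Data.List.Relation.Unary.Any using (here; there)
import Data.List.Relation.Unary.All as All
open import Data.List.Relation.Unary.AllPairs using ([]; _∷_)
open import Data.List.Relation.Unary.Unique.Propositional using (Unique)
open import Data.List.Membership.Propositional using (_∈_; _─_)
open import Data.List.Membership.Propositional.Properties using (∈-length)
open import Data.List.Relation.Binary.Subset.Propositional using (_⊆_)
open import Relation.Binary.PropositionalEquality

open ≤-Reasoning

private
  variable
    n : ℕ
    E : Set

^-distribʳ-* : ∀ m n o → (m * n) ^ o ≡ m ^ o * n ^ o
^-distribʳ-* m n zero    = refl
^-distribʳ-* m n (suc o) = begin-equality
  m * n * (m * n) ^ o     ≡⟨ cong (m * n *_) (^-distribʳ-* m n o) ⟩
  m * n * (m ^ o * n ^ o) ≡⟨ *-*-interchange m n _ _ ⟩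
  m ^ suc o * n ^ suc o   ∎
  where
  *-*-interchange : ∀ a b c d → a * b * (c * d) ≡ a * c * (b * d)
  *-*-interchange = solve-∀

n^n≢0 : ∀ n → NonZero (n ^ n)
n^n≢0 zero    = _
n^n≢0 (suc n) = m^n≢0 (suc n) (suc n)

n^n>0 : ∀ n → n ^ n > 0
n^n>0 n = >-nonZero⁻¹ (n ^ n) {{n^n≢0 n}}

suc^k-bound : ∀ k {r t} → k + r ≡ t → suc t ^ k * suc r ≤ t ^ k * suc t
suc^k-bound zero    refl = ≤-refl
suc^k-bound (suc k) {r} refl = begin
  suc t ^ suc k * suc r         ≡⟨ *-assoc (suc t) (suc t ^ k) (suc r) ⟩
  suc t * (suc t ^ k * suc r)   ≡⟨ swap (suc t) (suc t ^ k) (suc r) ⟩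
  suc t ^ k * (suc t * suc r)   ≤⟨ *-monoʳ-≤ (suc t ^ k) step ⟩
  suc t ^ k * (t * suc (suc r)) ≡⟨ swap (suc t ^ k) t (suc (suc r)) ⟩
  t * (suc t ^ k * suc (suc r)) ≤⟨ *-monoʳ-≤ t (suc^k-bound k (+-suc k r)) ⟩
  t * (t ^ k * suc t)           ≡⟨ *-assoc t (t ^ k) (suc t) ⟨
  t ^ suc k * suc t             ∎
  where
  t = suc (k + r)
  swap : ∀ a b c → a * (b * c) ≡ b * (a * c)
  swap = solve-∀
  step : suc t * suc r ≤ t * suc (suc r)
  step = m+n≤o⇒m≤o (suc t * suc r) (≤-reflexive (identity k r))
    where
    identity : ∀ k r → (2 + k + r) * (1 + r) + k ≡ (1 + k + r) * (2 + r)
    identity = solve-∀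

selfPow-logConvex : ∀ x → suc x ^ suc x * suc x ^ suc x ≤ x ^ x * (2 + x) ^ (2 + x)
-- With t = x(x + 2) one has (x + 1)² = t + 1, so suc^k-bound with k = x bounds ((t + 1)/t)^x;
-- what remains is the quartic inequality (x + 1)⁴ ≤ (x + 2)²(x² + x + 1).
selfPow-logConvex x = *-cancelʳ-≤ _ _ (suc r) lemma
  where
  u = suc x
  v = 2 + x
  t = x * v
  r = x * x + x
  u²≡suc[t] : u * u ≡ suc t
  u²≡suc[t] = identity x
    where
    identity : ∀ x → suc x * suc x ≡ suc (x * (2 + x))
    identity = solve-∀
  x+r≡t : x + r ≡ t
  x+r≡t = identity x
    where
    identity : ∀ x → x + (x * x + x) ≡ x * (2 + x)
    identity = solve-∀
  quartic : suc t * suc t ≤ v * v * suc r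
  quartic = m+n≤o⇒m≤o (suc t * suc t) (≤-reflexive (identity x))
    where
    identity : ∀ x → suc (x * (2 + x)) * suc (x * (2 + x)) + (x * x * x + 3 * (x * x) + 4 * x + 3)
                   ≡ (2 + x) * (2 + x) * suc (x * x + x)
    identity = solve-∀
  lemma : u ^ u * u ^ u * suc r ≤ x ^ x * v ^ v * suc r
  lemma = begin
    u ^ u * u ^ u * suc r               ≡⟨ cong (_* suc r) (^-distribʳ-* u u u) ⟨
    (u * u) ^ u * suc r                 ≡⟨ cong (λ s → s ^ u * suc r) u²≡suc[t] ⟩
    suc t ^ u * suc r                   ≡⟨ rearrange (suc t) (suc t ^ x) (suc r) ⟩
    suc t ^ x * suc r * suc t           ≤⟨ *-monoˡ-≤ (suc t) (suc^k-bound x x+r≡t) ⟩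
    t ^ x * suc t * suc t               ≡⟨ *-assoc (t ^ x) (suc t) (suc t) ⟩
    t ^ x * (suc t * suc t)             ≤⟨ *-monoʳ-≤ (t ^ x) quartic ⟩
    t ^ x * (v * v * suc r)             ≡⟨ cong (_* (v * v * suc r)) (^-distribʳ-* x v x) ⟩
    x ^ x * v ^ x * (v * v * suc r)     ≡⟨ rearrange′ (x ^ x) (v ^ x) v (suc r) ⟩
    x ^ x * v ^ v * suc r               ∎
    where
    rearrange : ∀ a b c → a * b * c ≡ b * c * a
    rearrange = solve-∀
    rearrange′ : ∀ a b c d → a * b * (c * c * d) ≡ a * (c * (c * b)) * d
    rearrange′ = solve-∀

selfPow-ratio-mono : ∀ {x y} → x ≤ y → suc x ^ suc x * y ^ y ≤ suc y ^ suc y * x ^ x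
selfPow-ratio-mono x≤y = go (≤⇒≤′ x≤y)
  where
  go : ∀ {x y} → x ≤′ y → suc x ^ suc x * y ^ y ≤ suc y ^ suc y * x ^ x
  go ≤′-refl = ≤-refl
  go {x} (≤′-step {y} x≤y) = *-cancelʳ-≤ _ _ (y ^ y) {{n^n≢0 y}} (begin
    X * Y * y ^ y      ≡⟨ swap X Y (y ^ y) ⟩
    X * y ^ y * Y      ≤⟨ *-monoˡ-≤ Y (go x≤y) ⟩
    Y * x ^ x * Y      ≡⟨ swap Y (x ^ x) Y ⟩
    Y * Y * x ^ x      ≤⟨ *-monoˡ-≤ (x ^ x) (selfPow-logConvex y) ⟩
    y ^ y * Y′ * x ^ x ≡⟨ rotate (y ^ y) Y′ (x ^ x) ⟩
    Y′ * x ^ x * y ^ y  ∎)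
    where
    X = suc x ^ suc x
    Y = suc y ^ suc y
    Y′ = (2 + y) ^ (2 + y)
    swap : ∀ a b c → a * b * c ≡ a * c * b
    swap = solve-∀
    rotate : ∀ a b c → a * b * c ≡ b * c * a
    rotate = solve-∀

selfPow-split-diag : ∀ c → c ^ c * c ^ c * 4 ^ c ≡ (c + c) ^ (c + c)
selfPow-split-diag c = begin-equality
  c ^ c * c ^ c * 4 ^ c     ≡⟨ cong (_* 4 ^ c) (^-distribʳ-* c c c) ⟨
  (c * c) ^ c * 4 ^ c       ≡⟨ ^-distribʳ-* (c * c) 4 c ⟨
  (c * c * 4) ^ c           ≡⟨ cong (_^ c) (identity c) ⟩
  ((c + c) * (c + c)) ^ c   ≡⟨ ^-distribʳ-* (c + c) (c + c) c ⟩
  (c + c) ^ c * (c + c) ^ c ≡⟨ ^-distribˡ-+-* (c + c) c c ⟨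
  (c + c) ^ (c + c)         ∎
  where
  identity : ∀ c → c * c * 4 ≡ (c + c) * (c + c)
  identity = solve-∀

selfPow-split-≥ : ∀ {b c} → c ≤ b → b ^ b * c ^ c * 4 ^ c ≤ (b + c) ^ (b + c)
selfPow-split-≥ {c = c} c≤b = go (≤⇒≤′ c≤b)
  where
  go : ∀ {b} → c ≤′ b → b ^ b * c ^ c * 4 ^ c ≤ (b + c) ^ (b + c)
  go ≤′-refl = ≤-reflexive (selfPow-split-diag c)
  go (≤′-step {b} c≤b) = *-cancelʳ-≤ _ _ (b ^ b) {{n^n≢0 b}} (begin
    suc b ^ suc b * c ^ c * 4 ^ c * b ^ b   ≡⟨ rearrange (suc b ^ suc b) (c ^ c) (4 ^ c) (b ^ b) ⟩
    suc b ^ suc b * (b ^ b * c ^ c * 4 ^ c) ≤⟨ *-monoʳ-≤ (suc b ^ suc b) (go c≤b) ⟩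
    suc b ^ suc b * (b + c) ^ (b + c)       ≤⟨ selfPow-ratio-mono (m≤m+n b c) ⟩
    suc (b + c) ^ suc (b + c) * b ^ b       ∎)
    where
    rearrange : ∀ a p q r → a * p * q * r ≡ a * (r * p * q)
    rearrange = solve-∀

selfPow-split : ∀ {b c z} → z ≤ b → z ≤ c → b ^ b * c ^ c * 4 ^ z ≤ (b + c) ^ (b + c)
selfPow-split {b} {c} {z} z≤b z≤c with ≤-total c b
... | inj₁ c≤b = begin
  b ^ b * c ^ c * 4 ^ z ≤⟨ *-monoʳ-≤ (b ^ b * c ^ c) (^-monoʳ-≤ 4 z≤c) ⟩
  b ^ b * c ^ c * 4 ^ c ≤⟨ selfPow-split-≥ c≤b ⟩
  (b + c) ^ (b + c)     ∎
... | inj₂ b≤c = begin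
  b ^ b * c ^ c * 4 ^ z ≡⟨ cong (_* 4 ^ z) (*-comm (b ^ b) (c ^ c)) ⟩
  c ^ c * b ^ b * 4 ^ z ≤⟨ *-monoʳ-≤ (c ^ c * b ^ b) (^-monoʳ-≤ 4 z≤b) ⟩
  c ^ c * b ^ b * 4 ^ b ≤⟨ selfPow-split-≥ b≤c ⟩
  (c + b) ^ (c + b)     ≡⟨ cong (λ m → m ^ m) (+-comm c b) ⟩
  (b + c) ^ (b + c)     ∎

4^-split : ∀ s t {b c z} → z ≤ b → z ≤ c → 4 ^ s ≤ b ^ b → 4 ^ t ≤ c ^ c →
           4 ^ (s + t + z) ≤ (b + c) ^ (b + c)
4^-split s t {b} {c} {z} z≤b z≤c 4ˢ≤bᵇ 4ᵗ≤cᶜ = begin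
  4 ^ (s + t + z)       ≡⟨ ^-distribˡ-+-* 4 (s + t) z ⟩
  4 ^ (s + t) * 4 ^ z   ≡⟨ cong (_* 4 ^ z) (^-distribˡ-+-* 4 s t) ⟩
  4 ^ s * 4 ^ t * 4 ^ z ≤⟨ *-monoˡ-≤ (4 ^ z) (*-mono-≤ 4ˢ≤bᵇ 4ᵗ≤cᶜ) ⟩
  b ^ b * c ^ c * 4 ^ z ≤⟨ selfPow-split z≤b z≤c ⟩
  (b + c) ^ (b + c)     ∎

∈-─⁺ : ∀ {x y : E} {ys} (x∈ys : x ∈ ys) → y ∈ ys → y ≢ x → y ∈ ys ─ x∈ys
∈-─⁺ (here refl)  (here refl)  y≢x = ⊥-elim (y≢x refl)
∈-─⁺ (here _)     (there y∈ys) _   = y∈ys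
∈-─⁺ (there _)    (here y≡z)   _   = here y≡z
∈-─⁺ (there x∈ys) (there y∈ys) y≢x = there (∈-─⁺ x∈ys y∈ys y≢x)

Unique-⊆⇒length≤ : ∀ {xs ys : List E} → Unique xs → xs ⊆ ys → length xs ≤ length ys
Unique-⊆⇒length≤ [] _ = z≤n
Unique-⊆⇒length≤ {xs = x ∷ xs} {ys} (x∉xs ∷ xs!) x∷xs⊆ys = begin
  suc (length xs)          ≤⟨ s≤s (Unique-⊆⇒length≤ xs! xs⊆ys─x) ⟩
  suc (length (ys ─ x∈ys)) ≡⟨ length-removeAt′ ys _ ⟨
  length ys                ∎
  where
  x∈ys = x∷xs⊆ys (here refl)
  xs⊆ys─x : xs ⊆ ys ─ x∈ys
  xs⊆ys─x y∈xs = ∈-─⁺ x∈ys (x∷xs⊆ys (there y∈xs)) (λ y≡x → All.lookup x∉xs y∈xs (sym y≡x))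

totalWeight : List (Vec ℕ n) → ℕ
totalWeight A = sum (map w A)

totalWeight-Vec0 : (A : List (Vec ℕ 0)) → totalWeight A ≡ 0
totalWeight-Vec0 []       = refl
totalWeight-Vec0 ([] ∷ A) = totalWeight-Vec0 A

slice₀ : List (Vec ℕ (suc n)) → List (Vec ℕ n)
slice₀ []                = []
slice₀ ((zero  ∷ t) ∷ A) = t ∷ slice₀ A
slice₀ ((suc _ ∷ _) ∷ A) = slice₀ A

shift : List (Vec ℕ (suc n)) → List (Vec ℕ (suc n))
shift []                = []
shift ((zero  ∷ _) ∷ A) = shift A
shift ((suc k ∷ t) ∷ A) = (k ∷ t) ∷ shift A

length-split : (A : List (Vec ℕ (suc n))) → length A ≡ length (slice₀ A) + length (shift A)
length-split []                = refl
length-split ((zero  ∷ _) ∷ A) = cong suc (length-split A)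
length-split ((suc _ ∷ _) ∷ A) = trans (cong suc (length-split A)) (sym (+-suc _ _))

-- Every vector of positive first coordinate keeps its weight under the shift, except those
-- with first coordinate 1, which land in slice₀ (shift A) and lose one.
totalWeight-split : (A : List (Vec ℕ (suc n))) →
  totalWeight A ≡ totalWeight (slice₀ A) + totalWeight (shift A) + length (slice₀ (shift A))
totalWeight-split [] = refl
totalWeight-split ((k ∷ t) ∷ A) = trans (cong (w (k ∷ t) +_) (totalWeight-split A)) (step k)
  where
  b = totalWeight (slice₀ A)
  c = totalWeight (shift A)
  z = length (slice₀ (shift A))
  step : ∀ h → w (h ∷ t) + (b + c + z) ≡
         totalWeight (slice₀ ((h ∷ t) ∷ A)) + totalWeight (shift ((h ∷ t) ∷ A))
         + length (slice₀ (shift ((h ∷ t) ∷ A)))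
  step zero          = identity₀ (w t) b c z
    where
    identity₀ : ∀ a b c d → a + (b + c + d) ≡ a + b + c + d
    identity₀ = solve-∀
  step (suc zero)    = identity₁ (w t) b c z
    where
    identity₁ : ∀ a b c d → suc (a + (b + c + d)) ≡ b + (a + c) + suc d
    identity₁ = solve-∀
  step (suc (suc _)) = identity₂ (w t) b c z
    where
    identity₂ : ∀ a b c d → suc (a + (b + c + d)) ≡ b + suc (a + c) + d
    identity₂ = solve-∀

∈-slice₀⁺ : ∀ {t : Vec ℕ n} (A : List (Vec ℕ (suc n))) → (zero ∷ t) ∈ A → t ∈ slice₀ A
∈-slice₀⁺ ((zero  ∷ _) ∷ A) (here refl) = here refl
∈-slice₀⁺ ((zero  ∷ _) ∷ A) (there p)   = there (∈-slice₀⁺ A p)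
∈-slice₀⁺ ((suc _ ∷ _) ∷ A) (there p)   = ∈-slice₀⁺ A p

∈-slice₀⁻ : ∀ {t : Vec ℕ n} (A : List (Vec ℕ (suc n))) → t ∈ slice₀ A → (zero ∷ t) ∈ A
∈-slice₀⁻ ((zero  ∷ _) ∷ A) (here refl) = here refl
∈-slice₀⁻ ((zero  ∷ _) ∷ A) (there p)   = there (∈-slice₀⁻ A p)
∈-slice₀⁻ ((suc _ ∷ _) ∷ A) p           = there (∈-slice₀⁻ A p)

∈-shift⁺ : ∀ {k} {t : Vec ℕ n} (A : List (Vec ℕ (suc n))) → (suc k ∷ t) ∈ A → (k ∷ t) ∈ shift A
∈-shift⁺ ((zero  ∷ _) ∷ A) (there p)   = ∈-shift⁺ A p
∈-shift⁺ ((suc _ ∷ _) ∷ A) (here refl) = here refl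
∈-shift⁺ ((suc _ ∷ _) ∷ A) (there p)   = there (∈-shift⁺ A p)

∈-shift⁻ : ∀ {k} {t : Vec ℕ n} (A : List (Vec ℕ (suc n))) → (k ∷ t) ∈ shift A → (suc k ∷ t) ∈ A
∈-shift⁻ ((zero  ∷ _) ∷ A) p           = there (∈-shift⁻ A p)
∈-shift⁻ ((suc _ ∷ _) ∷ A) (here refl) = here refl
∈-shift⁻ ((suc _ ∷ _) ∷ A) (there p)   = there (∈-shift⁻ A p)

slice₀-Unique : (A : List (Vec ℕ (suc n))) → Unique A → Unique (slice₀ A)
slice₀-Unique []                _          = []
slice₀-Unique ((suc _ ∷ _) ∷ A) (_   ∷ A!) = slice₀-Unique A A!
slice₀-Unique ((zero  ∷ t) ∷ A) (x∉A ∷ A!) = All.tabulate t∉slice₀ ∷ slice₀-Unique A A!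
  where
  t∉slice₀ : ∀ {s} → s ∈ slice₀ A → t ≢ s
  t∉slice₀ p refl = All.lookup x∉A (∈-slice₀⁻ A p) refl

shift-Unique : (A : List (Vec ℕ (suc n))) → Unique A → Unique (shift A)
shift-Unique []                _          = []
shift-Unique ((zero  ∷ _) ∷ A) (_   ∷ A!) = shift-Unique A A!
shift-Unique ((suc k ∷ t) ∷ A) (x∉A ∷ A!) = All.tabulate x∉shift ∷ shift-Unique A A!
  where
  x∉shift : ∀ {y} → y ∈ shift A → k ∷ t ≢ y
  x∉shift p refl = All.lookup x∉A (∈-shift⁻ A p) refl

slice₀-IsDownset : (A : List (Vec ℕ (suc n))) → IsDownset A → IsDownset (slice₀ A)
slice₀-IsDownset A A↓ a z a∈ z≤a = ∈-slice₀⁺ A (A↓ (zero ∷ a) (zero ∷ z) (∈-slice₀⁻ A a∈) (z≤n ∷ z≤a))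

shift-IsDownset : (A : List (Vec ℕ (suc n))) → IsDownset A → IsDownset (shift A)
shift-IsDownset A A↓ (i ∷ a) (j ∷ z) a∈ (j≤i ∷ z≤a) =
  ∈-shift⁺ A (A↓ (suc i ∷ a) (suc j ∷ z) (∈-shift⁻ A a∈) (s≤s j≤i ∷ z≤a))

slice₀-shift⊆slice₀ : (A : List (Vec ℕ (suc n))) → IsDownset A → slice₀ (shift A) ⊆ slice₀ A
slice₀-shift⊆slice₀ A A↓ {t} p =
  ∈-slice₀⁺ A (A↓ (1 ∷ t) (0 ∷ t) (∈-shift⁻ A (∈-slice₀⁻ (shift A) p)) (z≤n ∷ Pointwise.refl ≤-refl))

shift-shorter : ∀ {a} (A : List (Vec ℕ (suc n))) → IsDownset A → a ∈ A → length (shift A) < length A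
shift-shorter {a = i ∷ t} A A↓ a∈A = begin-strict
  length (shift A)                       <⟨ +-monoˡ-< (length (shift A)) (∈-length t∈slice₀) ⟩
  length (slice₀ A) + length (shift A)   ≡⟨ length-split A ⟨
  length A                               ∎
  where
  t∈slice₀ = ∈-slice₀⁺ A (A↓ (i ∷ t) (0 ∷ t) a∈A (z≤n ∷ Pointwise.refl ≤-refl))

4^totalWeight-split : (A : List (Vec ℕ (suc n))) → Unique A → IsDownset A →
  4 ^ totalWeight (slice₀ A) ≤ length (slice₀ A) ^ length (slice₀ A) →
  4 ^ totalWeight (shift A) ≤ length (shift A) ^ length (shift A) →
  4 ^ totalWeight A ≤ length A ^ length A
4^totalWeight-split A A! A↓ slice₀-bound shift-bound
  rewrite totalWeight-split A | length-split A =
    4^-split (totalWeight (slice₀ A)) (totalWeight (shift A)) z≤b z≤c slice₀-bound shift-bound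
  where
  z≤b = Unique-⊆⇒length≤ (slice₀-Unique (shift A) (shift-Unique A A!)) (slice₀-shift⊆slice₀ A A↓)
  z≤c = ≤-trans (m≤m+n _ _) (≤-reflexive (sym (length-split (shift A))))

4^totalWeight≤length^length : ∀ n (A : List (Vec ℕ n)) → Unique A → IsDownset A →
  4 ^ totalWeight A ≤ length A ^ length A
4^totalWeight≤length^length zero A _ _ rewrite totalWeight-Vec0 A = n^n>0 (length A)
4^totalWeight≤length^length (suc n) A = go (length A) A ≤-refl
  where
  go : ∀ k (A : List (Vec ℕ (suc n))) → length A ≤ k → Unique A → IsDownset A →
       4 ^ totalWeight A ≤ length A ^ length A
  go _       []        _       _  _  = ≤-refl
  go (suc k) A@(_ ∷ _) |A|≤1+k A! A↓ = 4^totalWeight-split A A! A↓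
    (4^totalWeight≤length^length n (slice₀ A) (slice₀-Unique A A!) (slice₀-IsDownset A A↓))
    (go k (shift A) |shift|≤k (shift-Unique A A!) (shift-IsDownset A A↓))
    where
    |shift|≤k = ≤-pred (≤-trans (shift-shorter A A↓ (here refl)) |A|≤1+k)

theorem1p7 : (n : ℕ) → n ≥ 1 → (A : List (Vec ℕ n)) → Unique A → length A ≥ 1 → IsDownset A →
    2 ^ (2 * sum (map w A)) ≤ length A ^ length A
theorem1p7 n _ A A! _ A↓ =
  subst (_≤ length A ^ length A) (^-*-assoc 2 2 (totalWeight A)) (4^totalWeight≤length^length n A A! A↓)
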